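{- Let $p,q\ge 3$ be relatively prime odd integers and let $r$ be the unique integer in the interval $(0,pq)$ with $r\equiv 1\pmod p$ and $r\equiv -1\pmod q$. Then the chordal ring $\mathrm{CR}(pq,r)$ is edge transitive.
   Context: For integers $n$ and $k$ with $1<k<n-1$, the chordal ring $\mathrm{CR}(n,k)$ is the graph with vertex set $\mathbb{Z}_n$ (integers modulo $n$) and edge set $\{\{a,a+1\}:a\in\mathbb{Z}_n\}\cup\{\{a,a+k\}:a\in\mathbb{Z}_n\}$. A graph is edge transitive if for any two edges there is a graph automorphism mapping one to the other. -}

module Defs where

open import Data.Nat using (ℕ; _+_; _%_; NonZero)
open import Data.Fin using (Fin; toℕ)
open import Data.Sum using (_⊎_)
open import Data.Product using (Σ; _×_; ∃)
open import Function.Bundles using (_⤖_; Bijection)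
open import Relation.Binary.PropositionalEquality using (_≡_)

StepFrom : (n : ℕ) → .{{NonZero n}} → ℕ → Fin n → Fin n → Set
StepFrom n s a b = toℕ b ≡ (toℕ a + s) % n

Adj : (n : ℕ) → .{{NonZero n}} → ℕ → Fin n → Fin n → Set
Adj n k a b =
  (StepFrom n 1 a b ⊎ StepFrom n 1 b a) ⊎ (StepFrom n k a b ⊎ StepFrom n k b a)

IsAutomorphism : (n : ℕ) → .{{NonZero n}} → ℕ → (Fin n ⤖ Fin n) → Set
IsAutomorphism n k σ =
  ∀ a b → (Adj n k a b → Adj n k (f a) (f b)) × (Adj n k (f a) (f b) → Adj n k a b)
  where f = Bijection.to σ

MapsPair : {n : ℕ} → (Fin n → Fin n) → Fin n → Fin n → Fin n → Fin n → Set
MapsPair f a b c d = (f a ≡ c × f b ≡ d) ⊎ (f a ≡ d × f b ≡ c)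

EdgeTransitive : (n : ℕ) → .{{NonZero n}} → ℕ → Set
EdgeTransitive n k =
  ∀ a b c d → Adj n k a b → Adj n k c d →
  Σ (Fin n ⤖ Fin n) λ σ → IsAutomorphism n k σ × MapsPair (Bijection.to σ) a b c d

module Submission where

-- The theorem is an instance of a general fact: if r² ≡ 1 (mod n),
-- then every affine map  x ↦ u·x + k  of ℤ_n with u ∈ {1, r} is an automorphism
-- of CR(n,r).  Multiplication by r exchanges the two step lengths 1 and r (as
-- r·r ≡ 1), multiplication by 1 fixes them, and translations preserve every
-- step.  Choosing u to turn the step of one arc into the step of another and k
-- to move the tail onto the tail makes CR(n,r) arc transitive, hence edge
-- transitive.  Under the hypotheses of the theorem, r ≡ 1 (mod p) and
-- r ≡ -1 (mod q) give p·q ∣ (r - 1)(r + 1), i.e. r² ≡ 1 (mod pq).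

open import Defs
open import Data.Nat using (ℕ; suc; pred; _+_; _*_; _%_; _≤_; _<_; NonZero; s≤s)
open import Data.Nat.Properties using (suc-pred; *-comm; +-comm; +-assoc; +-identityʳ; *-identityˡ; *-identityʳ)
open import Data.Nat.DivMod using (m%n%n≡m%n; %-distribˡ-+; %-distribˡ-*; m*n%n≡0; m%n<n; m<n⇒m%n≡m; %-remove-+ˡ)
open import Data.Nat.Divisibility using (_∣_; m%n≡0⇒n∣m; *-pres-∣)
open import Data.Nat.Coprimality using (Coprime)
open import Data.Nat.Tactic.RingSolver using (solve)
open import Data.Fin using (Fin; toℕ; fromℕ<)
open import Data.Fin.Properties using (toℕ-injective; toℕ<n; toℕ-fromℕ<)
open import Data.Product using (Σ; _×_; _,_; swap)
open import Data.Sum using (_⊎_; inj₁; inj₂)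
open import Data.List using ([]; _∷_)
open import Function using (_∘_)
open import Function.Bundles using (_⤖_; Bijection; mk↔ₛ′)
open import Function.Properties.Inverse using (↔⇒⤖)
open import Relation.Binary.Bundles using (Setoid)
open import Relation.Nullary using (¬_)
open import Relation.Binary.PropositionalEquality using (_≡_; refl; sym; trans; cong; cong₂; subst₂; setoid)
open import Level using (0ℓ)
import Relation.Binary.Construct.On as On
import Relation.Binary.Reasoning.Setoid as SetoidReasoning

module Congruence (n : ℕ) .{{_ : NonZero n}} where

  infix 4 _≈_
  _≈_ : ℕ → ℕ → Set
  a ≈ b = a % n ≡ b % n

  ≈-setoid : Setoid 0ℓ 0ℓ
  ≈-setoid = On.setoid (setoid ℕ) (_% n)

  module ≈-Reasoning = SetoidReasoning ≈-setoid

  ≡⇒≈ : ∀ {a b} → a ≡ b → a ≈ b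
  ≡⇒≈ = cong (_% n)

  %-≈ : ∀ a → a % n ≈ a
  %-≈ a = m%n%n≡m%n a n

  +-cong : ∀ {a a′ b b′} → a ≈ a′ → b ≈ b′ → a + b ≈ a′ + b′
  +-cong {a} {a′} {b} {b′} a≈a′ b≈b′ = trans (%-distribˡ-+ a b n)
    (trans (cong₂ (λ x y → (x + y) % n) a≈a′ b≈b′) (sym (%-distribˡ-+ a′ b′ n)))

  *-cong : ∀ {a a′ b b′} → a ≈ a′ → b ≈ b′ → a * b ≈ a′ * b′
  *-cong {a} {a′} {b} {b′} a≈a′ b≈b′ = trans (%-distribˡ-* a b n)
    (trans (cong₂ (λ x y → (x * y) % n) a≈a′ b≈b′) (sym (%-distribˡ-* a′ b′ n)))

  -- The additive inverse of x modulo n, represented by (n - 1)·x.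
  -_ : ℕ → ℕ
  - x = pred n * x

  +-inverseʳ : ∀ x → x + - x ≈ 0
  +-inverseʳ x = begin
    x + pred n * x  ≡⟨ cong (_* x) (suc-pred n) ⟩
    n * x           ≡⟨ *-comm n x ⟩
    x * n           ≈⟨ trans (m*n%n≡0 x n) (sym (m*n%n≡0 0 n)) ⟩
    0               ∎
    where open ≈-Reasoning

  +-inverseˡ : ∀ x → - x + x ≈ 0
  +-inverseˡ x = trans (≡⇒≈ (+-comm (- x) x)) (+-inverseʳ x)

  +-cancelˡ : ∀ a {x y} → a + x ≈ a + y → x ≈ y
  +-cancelˡ a {x} {y} a+x≈a+y = begin
    x                 ≈⟨ +-cong (+-inverseˡ a) refl ⟨
    (- a + a) + x     ≡⟨ +-assoc (- a) a x ⟩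
    - a + (a + x)     ≈⟨ +-cong { - a} refl a+x≈a+y ⟩
    - a + (a + y)     ≡⟨ +-assoc (- a) a y ⟨
    (- a + a) + y     ≈⟨ +-cong (+-inverseˡ a) refl ⟩
    y                 ∎
    where open ≈-Reasoning

  ≈0⇒∣ : ∀ {x} → x ≈ 0 → n ∣ x
  ≈0⇒∣ {x} x≈0 = m%n≡0⇒n∣m x n (trans x≈0 (m*n%n≡0 0 n))

module Circulant (n : ℕ) .{{_ : NonZero n}} where

  open Congruence n

  vertex : ℕ → Fin n
  vertex a = fromℕ< (m%n<n a n)

  toℕ-vertex : ∀ a → toℕ (vertex a) ≈ a
  toℕ-vertex a = trans (≡⇒≈ (toℕ-fromℕ< (m%n<n a n))) (%-≈ a)

  ≈⇒≡ : ∀ {x y : Fin n} → toℕ x ≈ toℕ y → x ≡ y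
  ≈⇒≡ {x} {y} x≈y = toℕ-injective (trans (reduced x) (trans x≈y (sym (reduced y))))
    where
    reduced : ∀ (z : Fin n) → toℕ z ≡ toℕ z % n
    reduced z = sym (m<n⇒m%n≡m (toℕ<n z))

  -- b = a + s in ℤ_n, phrased as a congruence (a record, so that s, a, b
  -- can be inferred from the type)
  record Step (s : ℕ) (a b : Fin n) : Set where
    constructor step
    field congruent : toℕ b ≈ toℕ a + s

  StepFrom⇒Step : ∀ {s a b} → StepFrom n s a b → Step s a b
  StepFrom⇒Step {s} {a} e = step (trans (≡⇒≈ e) (%-≈ (toℕ a + s)))

  Step⇒StepFrom : ∀ {s a b} → Step s a b → StepFrom n s a b
  Step⇒StepFrom {b = b} (step e) = trans (sym (m<n⇒m%n≡m (toℕ<n b))) e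

  step-cong : ∀ {s s′ a b} → s ≈ s′ → Step s a b → Step s′ a b
  step-cong s≈s′ (step a→b) = step (trans a→b (+-cong refl s≈s′))

  step-functional : ∀ {s a b b′} → Step s a b → Step s a b′ → b ≡ b′
  step-functional (step a→b) (step a→b′) = ≈⇒≡ (trans a→b (sym a→b′))

  affine : ℕ → ℕ → Fin n → Fin n
  affine u k x = vertex (u * toℕ x + k)

  affine-step : ∀ u k {s a b} → Step s a b → Step (u * s) (affine u k a) (affine u k b)
  affine-step u k {s} {a} {b} (step a→b) = step (begin
    toℕ (affine u k b)          ≈⟨ toℕ-vertex _ ⟩
    u * toℕ b + k               ≈⟨ +-cong (*-cong {u} refl a→b) refl ⟩
    u * (toℕ a + s) + k         ≡⟨ distribute u (toℕ a) s k ⟩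
    (u * toℕ a + k) + u * s     ≈⟨ +-cong (toℕ-vertex _) refl ⟨
    toℕ (affine u k a) + u * s  ∎)
    where
    open ≈-Reasoning
    distribute : ∀ u x s k → u * (x + s) + k ≡ (u * x + k) + u * s
    distribute u x s k = solve (u ∷ x ∷ s ∷ k ∷ [])

  affine-cancel : ∀ u k v l → u * v ≈ 1 → u * l + k ≈ 0 → ∀ x → affine u k (affine v l x) ≡ x
  affine-cancel u k v l uv≈1 ul+k≈0 x = ≈⇒≡ (begin
    toℕ (affine u k (affine v l x))  ≈⟨ toℕ-vertex _ ⟩
    u * toℕ (affine v l x) + k       ≈⟨ +-cong (*-cong {u} refl (toℕ-vertex _)) refl ⟩
    u * (v * toℕ x + l) + k          ≡⟨ regroup u v (toℕ x) l k ⟩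
    (u * v) * toℕ x + (u * l + k)    ≈⟨ +-cong (*-cong uv≈1 refl) ul+k≈0 ⟩
    1 * toℕ x + 0                    ≡⟨ unit (toℕ x) ⟩
    toℕ x                            ∎)
    where
    open ≈-Reasoning
    regroup : ∀ u v x l k → u * (v * x + l) + k ≡ (u * v) * x + (u * l + k)
    regroup u v x l k = solve (u ∷ v ∷ x ∷ l ∷ k ∷ [])
    unit : ∀ x → 1 * x + 0 ≡ x
    unit x = solve (x ∷ [])

  affine-inverseˡ : ∀ u k → u * u ≈ 1 → ∀ x → affine u (- (u * k)) (affine u k x) ≡ x
  affine-inverseˡ u k uu≈1 = affine-cancel u (- (u * k)) u k uu≈1 (+-inverseʳ (u * k))

  affine-inverseʳ : ∀ u k → u * u ≈ 1 → ∀ x → affine u k (affine u (- (u * k)) x) ≡ x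
  affine-inverseʳ u k uu≈1 = affine-cancel u k u (- (u * k)) uu≈1 (begin
    u * (pred n * (u * k)) + k  ≡⟨ regroup u (pred n) k ⟩
    pred n * ((u * u) * k) + k  ≈⟨ +-cong (*-cong {pred n} refl (*-cong uu≈1 refl)) refl ⟩
    pred n * (1 * k) + k        ≡⟨ cong (λ m → pred n * m + k) (*-identityˡ k) ⟩
    - k + k                     ≈⟨ +-inverseˡ k ⟩
    0                           ∎)
    where
    open ≈-Reasoning
    regroup : ∀ u m k → u * (m * (u * k)) + k ≡ m * ((u * u) * k) + k
    regroup u m k = solve (u ∷ m ∷ k ∷ [])

  affine-bijection : ∀ u k → u * u ≈ 1 → Fin n ⤖ Fin n
  affine-bijection u k uu≈1 = ↔⇒⤖ (mk↔ₛ′ (affine u k) (affine u (- (u * k)))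
    (affine-inverseʳ u k uu≈1) (affine-inverseˡ u k uu≈1))

  affine-hits : ∀ u a c → affine u (toℕ c + - (u * toℕ a)) a ≡ c
  affine-hits u a c = ≈⇒≡ (begin
    toℕ (affine u k a)                  ≈⟨ toℕ-vertex _ ⟩
    u * toℕ a + (toℕ c + - (u * toℕ a)) ≡⟨ exchange (u * toℕ a) (toℕ c) (- (u * toℕ a)) ⟩
    toℕ c + (u * toℕ a + - (u * toℕ a)) ≈⟨ +-cong {toℕ c} refl (+-inverseʳ (u * toℕ a)) ⟩
    toℕ c + 0                           ≡⟨ +-identityʳ (toℕ c) ⟩
    toℕ c                               ∎)
    where
    open ≈-Reasoning
    k = toℕ c + - (u * toℕ a)
    exchange : ∀ x y z → x + (y + z) ≡ y + (x + z)
    exchange x y z = solve (x ∷ y ∷ z ∷ [])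

module ChordalRing (n r : ℕ) .{{_ : NonZero n}} (r²≈1 : (r * r) % n ≡ 1 % n) where

  open Congruence n
  open Circulant n

  -- The step lengths 1 and r; under multiplication mod n they form the
  -- two-element group {1, r}, and _·_ is its multiplication table.
  data Generator : Set where
    one chord : Generator

  ⟦_⟧ : Generator → ℕ
  ⟦ one ⟧   = 1
  ⟦ chord ⟧ = r

  _·_ : Generator → Generator → Generator
  one   · h     = h
  chord · one   = chord
  chord · chord = one

  ⟦⟧-homo : ∀ g h → ⟦ g ⟧ * ⟦ h ⟧ ≈ ⟦ g · h ⟧
  ⟦⟧-homo one   h     = ≡⇒≈ (*-identityˡ ⟦ h ⟧)
  ⟦⟧-homo chord one   = ≡⇒≈ (*-identityʳ r)
  ⟦⟧-homo chord chord = r²≈1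

  ⟦⟧-square : ∀ g → ⟦ g ⟧ * ⟦ g ⟧ ≈ 1
  ⟦⟧-square one   = refl
  ⟦⟧-square chord = r²≈1

  -- every generator is its own inverse, so h · g is the element taking g to h
  ·-divides : ∀ g h → (h · g) · g ≡ h
  ·-divides one   one   = refl
  ·-divides one   chord = refl
  ·-divides chord one   = refl
  ·-divides chord chord = refl

  Arc : Generator → Fin n → Fin n → Set
  Arc g = Step ⟦ g ⟧

  Edge : Fin n → Fin n → Set
  Edge a b = Σ Generator λ g → Arc g a b ⊎ Arc g b a

  Adj⇒Edge : ∀ {a b} → Adj n r a b → Edge a b
  Adj⇒Edge (inj₁ (inj₁ a→b)) = one   , inj₁ (StepFrom⇒Step a→b)
  Adj⇒Edge (inj₁ (inj₂ b→a)) = one   , inj₂ (StepFrom⇒Step b→a)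
  Adj⇒Edge (inj₂ (inj₁ a→b)) = chord , inj₁ (StepFrom⇒Step a→b)
  Adj⇒Edge (inj₂ (inj₂ b→a)) = chord , inj₂ (StepFrom⇒Step b→a)

  Edge⇒Adj : ∀ {a b} → Edge a b → Adj n r a b
  Edge⇒Adj (one   , inj₁ a→b) = inj₁ (inj₁ (Step⇒StepFrom a→b))
  Edge⇒Adj (one   , inj₂ b→a) = inj₁ (inj₂ (Step⇒StepFrom b→a))
  Edge⇒Adj (chord , inj₁ a→b) = inj₂ (inj₁ (Step⇒StepFrom a→b))
  Edge⇒Adj (chord , inj₂ b→a) = inj₂ (inj₂ (Step⇒StepFrom b→a))

  affine-arc : ∀ u k {g a b} → Arc g a b → Arc (u · g) (affine ⟦ u ⟧ k a) (affine ⟦ u ⟧ k b)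
  affine-arc u k {g} a→b = step-cong (⟦⟧-homo u g) (affine-step ⟦ u ⟧ k a→b)

  affine-edge : ∀ u k {a b} → Edge a b → Edge (affine ⟦ u ⟧ k a) (affine ⟦ u ⟧ k b)
  affine-edge u k (g , inj₁ a→b) = u · g , inj₁ (affine-arc u k a→b)
  affine-edge u k (g , inj₂ b→a) = u · g , inj₂ (affine-arc u k b→a)

  automorphism : Generator → ℕ → Fin n ⤖ Fin n
  automorphism u k = affine-bijection ⟦ u ⟧ k (⟦⟧-square u)

  -- adjacency is preserved by the map and, via its affine inverse, reflected
  automorphism-preserves : ∀ u k → IsAutomorphism n r (automorphism u k)
  automorphism-preserves u k a b =
    (λ ab → Edge⇒Adj (affine-edge u k (Adj⇒Edge ab))) ,
    (λ σab → subst₂ (Adj n r) (back a) (back b)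
               (Edge⇒Adj (affine-edge u (- (⟦ u ⟧ * k)) (Adj⇒Edge σab))))
    where
    back : ∀ x → affine ⟦ u ⟧ (- (⟦ u ⟧ * k)) (affine ⟦ u ⟧ k x) ≡ x
    back = affine-inverseˡ ⟦ u ⟧ k (⟦⟧-square u)

  arc-transitive : ∀ {g h a b c d} → Arc g a b → Arc h c d →
    Σ (Fin n ⤖ Fin n) λ σ → IsAutomorphism n r σ ×
      (Bijection.to σ a ≡ c × Bijection.to σ b ≡ d)
  arc-transitive {g} {h} {a} {b} {c} {d} a→b c→d =
    automorphism u k , automorphism-preserves u k , σa≡c , σb≡d
    where
    u = h · g
    k = toℕ c + - (⟦ u ⟧ * toℕ a)
    σ = affine ⟦ u ⟧ k
    σa≡c : σ a ≡ c
    σa≡c = affine-hits ⟦ u ⟧ a c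
    c→σb : Arc h c (σ b)
    c→σb = subst₂ (λ g′ x → Arc g′ x (σ b)) (·-divides g h) σa≡c (affine-arc u k a→b)
    σb≡d : σ b ≡ d
    σb≡d = step-functional c→σb c→d

  relabel : ∀ {P Q : (Fin n ⤖ Fin n) → Set} → (∀ {σ} → P σ → Q σ) →
    Σ (Fin n ⤖ Fin n) (λ σ → IsAutomorphism n r σ × P σ) →
    Σ (Fin n ⤖ Fin n) (λ σ → IsAutomorphism n r σ × Q σ)
  relabel f (σ , aut , p) = σ , aut , f p

  edge-transitive : EdgeTransitive n r
  edge-transitive a b c d ab cd with Adj⇒Edge ab | Adj⇒Edge cd
  ... | _ , inj₁ a→b | _ , inj₁ c→d = relabel inj₁           (arc-transitive a→b c→d)
  ... | _ , inj₁ a→b | _ , inj₂ d→c = relabel inj₂           (arc-transitive a→b d→c)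
  ... | _ , inj₂ b→a | _ , inj₁ c→d = relabel (inj₂ ∘ swap)  (arc-transitive b→a c→d)
  ... | _ , inj₂ b→a | _ , inj₂ d→c = relabel (inj₁ ∘ swap)  (arc-transitive b→a d→c)

-- r ≡ 1 (mod p) and r ≡ -1 (mod q) imply r² ≡ 1 (mod pq): writing r = 1 + r′,
-- r² = r′·(r + 1) + 1 where p ∣ r′ and q ∣ r + 1.
square-≡-1 : ∀ p q r .{{_ : NonZero p}} .{{_ : NonZero q}} .{{_ : NonZero (p * q)}} →
  0 < r → r % p ≡ 1 % p → (r + 1) % q ≡ 0 → (r * r) % (p * q) ≡ 1 % (p * q)
square-≡-1 p q (suc r′) (s≤s _) r≡1 r+1≡0 =
  trans (cong (_% (p * q)) (expand r′)) (%-remove-+ˡ 1 (*-pres-∣ p∣r′ q∣r+1))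
  where
  p∣r′ : p ∣ r′
  p∣r′ = Congruence.≈0⇒∣ p (Congruence.+-cancelˡ p 1 r≡1)
  q∣r+1 : q ∣ suc r′ + 1
  q∣r+1 = m%n≡0⇒n∣m (suc r′ + 1) q r+1≡0
  expand : ∀ x → (1 + x) * (1 + x) ≡ x * ((1 + x) + 1) + 1
  expand x = solve (x ∷ [])

-- The oddness, coprimality and range hypotheses only make r unique; the
-- argument uses just r² ≡ 1 (mod pq).
proposition2 : (p q r : ℕ) → .{{_ : NonZero p}} → .{{_ : NonZero q}} → .{{_ : NonZero (p * q)}} →
    3 ≤ p → 3 ≤ q → ¬ (2 ∣ p) → ¬ (2 ∣ q) → Coprime p q →
    0 < r → r < p * q → r % p ≡ 1 % p → (r + 1) % q ≡ 0 →
    EdgeTransitive (p * q) r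
proposition2 p q r _ _ _ _ _ 0<r _ r≡1 r≡-1 =
  ChordalRing.edge-transitive (p * q) r (square-≡-1 p q r 0<r r≡1 r≡-1)
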